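{- Let $k\ge 1$ be an integer and let $G$ be a finite simple hamiltonian graph with average degree $\bar d>k-1$ (equivalently, $e(G)>|V(G)|(k-1)/2$). Then every $k$-spider is contained in $G$.
   Context: A spider is a tree with at most one vertex of degree greater than $2$; equivalently, a root vertex together with $f\ge1$ paths (legs) from the root that are otherwise pairwise vertex-disjoint. A $k$-spider $S_{\ell_1,\dots,\ell_f}$ has legs of lengths $\ell_1,\dots,\ell_f\ge1$ with $\ell_1+\dots+\ell_f=k$ (so it has $k$ edges). "Contained in $G$" means isomorphic to a (not necessarily induced) subgraph of $G$. A hamiltonian graph is one having a cycle through all its vertices. -}

module Defs where

open import Data.Nat using (ℕ; zero; suc; _+_; _*_; _∸_; _<_; _≤_)
open import Data.Fin using (Fin; toℕ) renaming (zero to fzero)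
open import Data.Fin.Properties using () renaming (_<?_ to _<ᶠ?_)
open import Data.List using (List; length; filter; allFin; concatMap; map; tabulate)
open import Data.Nat.ListAction using (sum)
open import Data.Product using (Σ; _×_; _,_; ∃)
open import Data.Sum using (_⊎_)
open import Data.Unit using (⊤)
open import Relation.Nullary using (¬_; Dec)
open import Relation.Nullary.Decidable using (_×-dec_)
open import Relation.Binary.PropositionalEquality using (_≡_)
open import Function.Definitions using (Injective)

record FinSimpleGraph (n : ℕ) : Set₁ where
  field
    Adj    : Fin n → Fin n → Set
    adj?   : (u v : Fin n) → Dec (Adj u v)
    sym    : ∀ {u v} → Adj u v → Adj v u
    irrefl : ∀ {u} → ¬ Adj u u
open FinSimpleGraph public

-- e(G): the number of edges, i.e. unordered pairs {u,v} (counted as u < v)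
-- with u adjacent to v.
edgeCount : ∀ {n} → FinSimpleGraph n → ℕ
edgeCount {n} G =
  length (filter (λ p → (Data.Product.proj₁ p <ᶠ? Data.Product.proj₂ p) ×-dec adj? G (Data.Product.proj₁ p) (Data.Product.proj₂ p))
                 (concatMap (λ u → map (λ v → (u , v)) (allFin n)) (allFin n)))

-- G is hamiltonian: it has a cycle through all its vertices, i.e. n ≥ 3 and
-- there is a cyclic ordering σ(0), σ(1), …, σ(n-1) of all vertices
-- (σ injective, hence a bijection) with consecutive vertices adjacent
-- (including σ(n-1) ~ σ(0)).
CyclicSucc : ∀ {n} → Fin n → Fin n → Set
CyclicSucc {n} i j = (toℕ j ≡ suc (toℕ i)) ⊎ ((toℕ i ≡ n ∸ 1) × (toℕ j ≡ 0))

Hamiltonian : ∀ {n} → FinSimpleGraph n → Set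
Hamiltonian {n} G =
  (3 ≤ n) ×
  Σ (Fin n → Fin n) λ σ →
    Injective _≡_ _≡_ σ × (∀ (i j : Fin n) → CyclicSucc i j → Adj G (σ i) (σ j))

-- The spider with f legs of lengths ℓ 0, …, ℓ (f-1):
-- vertices are the root and the pairs (leg i, position p) with p < ℓ i
-- (position p being at distance p+1 from the root).
data SpiderV (f : ℕ) (ℓ : Fin f → ℕ) : Set where
  root : SpiderV f ℓ
  leg  : (i : Fin f) → Fin (ℓ i) → SpiderV f ℓ

data SpiderEdge (f : ℕ) (ℓ : Fin f → ℕ) : SpiderV f ℓ → SpiderV f ℓ → Set where
  rootEdge : (i : Fin f) (z : Fin (ℓ i)) → toℕ z ≡ 0 → SpiderEdge f ℓ root (leg i z)
  legEdge  : (i : Fin f) (p q : Fin (ℓ i)) → toℕ q ≡ suc (toℕ p) →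
             SpiderEdge f ℓ (leg i p) (leg i q)

SpiderIn : ∀ {n} (f : ℕ) (ℓ : Fin f → ℕ) → FinSimpleGraph n → Set
SpiderIn {n} f ℓ G =
  Σ (SpiderV f ℓ → Fin n) λ φ →
    Injective _≡_ _≡_ φ × (∀ u v → SpiderEdge f ℓ u v → Adj G (φ u) (φ v))

-- The number of edges of S_{ℓ}: ℓ 0 + … + ℓ (f-1).
legSum : (f : ℕ) → (Fin f → ℕ) → ℕ
legSum f ℓ = sum (tabulate ℓ)

-- Double counting gives 2·e(G) ≤ Σ_v deg(v), so the density hypothesis
-- n(k-1) < 2·e(G) forces a vertex c with deg(c) ≥ k (pigeonhole).  Rotating
-- the hamiltonian cycle we obtain a hamiltonian path v₀ = c, v₁, …, v_{n-1}.
-- Let p₀ < p₁ < … < p_{d-1} be the positions on this path of the d ≥ k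
-- neighbours of c.  Consecutive neighbour positions differ by at least one,
-- so p_m + t ≤ p_{m+t}.  Give leg i the offset o_i = ℓ₀ + … + ℓ_{i-1} and
-- embed it as the path segment v_{p_{o_i}}, v_{p_{o_i}+1}, …, v_{p_{o_i}+ℓ_i-1}:
-- its first vertex is a neighbour of the root c, and the segments of
-- different legs are disjoint because p_{o_i} + ℓ_i ≤ p_{o_{i+1}}.
module Submission where

open import Defs hiding (sym)
open import Data.Bool using (true; false; if_then_else_)
open import Data.Nat using (ℕ; zero; suc; _+_; _*_; _∸_; _<_; _≤_; _<?_; z≤n; s≤s)
open import Data.Nat.Properties
open import Data.Fin using (Fin; toℕ; fromℕ<; punchOut) renaming (zero to fzero; suc to fsuc)
import Data.Fin.Properties as FinP
open import Data.List using (List; []; _∷_; length; filter; concatMap; map; tabulate; allFin; _++_)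
import Data.List.Properties as ListP
open import Data.Product using (_×_; _,_; ∃; proj₁; proj₂)
open import Data.Sum using (inj₁; inj₂)
open import Data.Empty using (⊥; ⊥-elim)
open import Function using (_∘_; id)
open import Function.Bundles using (mk⇔)
open import Function.Definitions using (Injective)
open import Relation.Nullary using (¬_; Dec; yes; no; does; contradiction)
open import Relation.Nullary.Decidable using (_×-dec_; dec-false; does-⇔)
open import Relation.Unary using (Decidable)
open import Relation.Binary using (tri<; tri≈; tri>)
open import Relation.Binary.PropositionalEquality
  using (_≡_; _≢_; refl; sym; trans; cong; subst; subst₂; module ≡-Reasoning)
open import Data.Fin.Permutation using (permutation)
open import Algebra.Properties.CommutativeMonoid.Sum +-0-commutativeMonoid
  using (sum; sum-cong-≗; sum-permute; ∑-comm; ∑-distrib-+)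

indicator : ∀ {p} {P : Set p} → Dec P → ℕ
indicator d = if does d then 1 else 0

indicator-⇔ : ∀ {p q} {P : Set p} {Q : Set q} → (P → Q) → (Q → P) →
  (p? : Dec P) (q? : Dec Q) → indicator p? ≡ indicator q?
indicator-⇔ P→Q Q→P p? q? = cong (λ b → if b then 1 else 0) (does-⇔ (mk⇔ P→Q Q→P) p? q?)

indicator-×-≤ : ∀ {p q} {P : Set p} {Q : Set q} (p? : Dec P) (q? : Dec Q) →
  indicator (p? ×-dec q?) ≤ indicator q?
indicator-×-≤ p? q? with does p?
... | true  = ≤-refl
... | false = z≤n

indicator-×-no : ∀ {p q} {P : Set p} {Q : Set q} (p? : Dec P) (q? : Dec Q) →
  ¬ P → indicator (p? ×-dec q?) ≡ 0
indicator-×-no p? q? ¬p rewrite dec-false p? ¬p = refl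

count-tabulate : ∀ {a p} {A : Set a} {P : A → Set p} (P? : Decidable P) {m} (g : Fin m → A) →
  length (filter P? (tabulate g)) ≡ sum (λ i → indicator (P? (g i)))
count-tabulate P? {zero}  g = refl
count-tabulate P? {suc m} g with does (P? (g fzero))
... | true  = cong suc (count-tabulate P? (g ∘ fsuc))
... | false = count-tabulate P? (g ∘ fsuc)

count-concatMap : ∀ {a b p} {A : Set a} {B : Set b} {P : B → Set p} (P? : Decidable P) {m}
  (h : A → List B) (g : Fin m → A) →
  length (filter P? (concatMap h (tabulate g))) ≡ sum (λ i → length (filter P? (h (g i))))
count-concatMap P? {zero}  h g = refl
count-concatMap P? {suc m} h g = begin
  length (filter P? (h (g fzero) ++ rest))
    ≡⟨ cong length (ListP.filter-++ P? (h (g fzero)) rest) ⟩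
  length (filter P? (h (g fzero)) ++ filter P? rest)
    ≡⟨ ListP.length-++ (filter P? (h (g fzero))) ⟩
  length (filter P? (h (g fzero))) + length (filter P? rest)
    ≡⟨ cong (length (filter P? (h (g fzero))) +_) (count-concatMap P? h (g ∘ fsuc)) ⟩
  sum (λ i → length (filter P? (h (g i)))) ∎
  where
  open ≡-Reasoning
  rest = concatMap h (tabulate (g ∘ fsuc))

sum-mono : ∀ {m} (f g : Fin m → ℕ) → (∀ i → f i ≤ g i) → sum f ≤ sum g
sum-mono {zero}  f g f≤g = z≤n
sum-mono {suc m} f g f≤g = +-mono-≤ (f≤g fzero) (sum-mono (f ∘ fsuc) (g ∘ fsuc) (f≤g ∘ fsuc))

exceeds-average : ∀ {m} (f : Fin m → ℕ) (c : ℕ) → m * c < sum f → ∃ λ i → c < f i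
exceeds-average {zero}  f c ()
exceeds-average {suc m} f c big with c <? f fzero
... | yes c<f₀ = fzero , c<f₀
... | no  c≮f₀ =
  let (i , c<fᵢ) = exceeds-average (f ∘ fsuc) c (+-cancelˡ-< c _ _ big′) in fsuc i , c<fᵢ
  where
  big′ : c + m * c < c + sum (f ∘ fsuc)
  big′ = ≤-trans big (+-monoˡ-≤ _ (≮⇒≥ c≮f₀))

-- Degrees and the handshake inequality 2·e(G) ≤ Σ deg

module _ {n : ℕ} (G : FinSimpleGraph n) where

  degree : Fin n → ℕ
  degree u = sum (λ v → indicator (adj? G u v))

  edgeFrom : Fin n → Fin n → ℕ
  edgeFrom u v = indicator ((u FinP.<? v) ×-dec adj? G u v)

  edgeCount-sum : edgeCount G ≡ sum (λ u → sum (λ v → edgeFrom u v))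
  edgeCount-sum =
    trans (count-concatMap isEdge (λ u → map (u ,_) (allFin n)) id)
          (sum-cong-≗ λ u → trans (cong (length ∘ filter isEdge) (ListP.map-tabulate id (u ,_)))
                                  (count-tabulate isEdge (u ,_)))
    where
    isEdge = λ (p : Fin n × Fin n) → (proj₁ p FinP.<? proj₂ p) ×-dec adj? G (proj₁ p) (proj₂ p)

  edgeFrom-pair : ∀ u v → edgeFrom u v + edgeFrom v u ≤ indicator (adj? G u v)
  edgeFrom-pair u v with u FinP.<? v
  ... | yes u<v = begin
    edgeFrom u v + edgeFrom v u ≡⟨ cong (edgeFrom u v +_) (indicator-×-no (v FinP.<? u) (adj? G v u) (<-asym u<v)) ⟩
    edgeFrom u v + 0            ≡⟨ +-identityʳ _ ⟩
    edgeFrom u v                ≤⟨ indicator-×-≤ (u FinP.<? v) (adj? G u v) ⟩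
    indicator (adj? G u v)      ∎
    where open ≤-Reasoning
  ... | no u≮v = begin
    edgeFrom u v + edgeFrom v u ≡⟨ cong (_+ edgeFrom v u) (indicator-×-no (u FinP.<? v) (adj? G u v) u≮v) ⟩
    edgeFrom v u                ≤⟨ indicator-×-≤ (v FinP.<? u) (adj? G v u) ⟩
    indicator (adj? G v u)      ≡⟨ indicator-⇔ (FinSimpleGraph.sym G) (FinSimpleGraph.sym G) (adj? G v u) (adj? G u v) ⟩
    indicator (adj? G u v)      ∎
    where open ≤-Reasoning

  -- Every edge is counted twice in Σ deg (once per endpoint).
  handshake : 2 * edgeCount G ≤ sum degree
  handshake = begin
    2 * edgeCount G                                   ≡⟨ cong (2 *_) edgeCount-sum ⟩
    2 * S                                             ≡⟨ cong (S +_) (+-identityʳ S) ⟩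
    S + S                                             ≡⟨ cong (S +_) (∑-comm edgeFrom) ⟩
    S + sum (λ u → sum (λ v → edgeFrom v u))          ≡⟨ sym (∑-distrib-+ (λ u → sum (edgeFrom u)) _) ⟩
    sum (λ u → sum (edgeFrom u) + sum (λ v → edgeFrom v u))
      ≡⟨ sum-cong-≗ (λ u → sym (∑-distrib-+ (edgeFrom u) _)) ⟩
    sum (λ u → sum (λ v → edgeFrom u v + edgeFrom v u))
      ≤⟨ sum-mono _ _ (λ u → sum-mono _ _ (edgeFrom-pair u)) ⟩
    sum degree                                        ∎
    where
    open ≤-Reasoning
    S = sum (λ u → sum (edgeFrom u))

injective⇒surjective : ∀ {n} (f : Fin n → Fin n) → Injective _≡_ _≡_ f → ∀ y → ∃ λ x → f x ≡ y
injective⇒surjective {suc m} f f-inj y with FinP.any? (λ x → f x FinP.≟ y)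
... | yes hit = hit
... | no miss = contradiction (FinP.injective⇒≤ squeeze-inj) 1+n≰n
  where
  -- If y were missed, f would inject Fin (suc m) into Fin m.
  squeeze : Fin (suc m) → Fin m
  squeeze x = punchOut {i = y} {j = f x} (λ y≡fx → miss (x , sym y≡fx))
  squeeze-inj : Injective _≡_ _≡_ squeeze
  squeeze-inj {a} {b} eq =
    f-inj (FinP.punchOut-injective {i = y} (λ e → miss (a , sym e)) (λ e → miss (b , sym e)) eq)

sum-reindex : ∀ {n} (τ : Fin n → Fin n) → Injective _≡_ _≡_ τ → (h : Fin n → ℕ) →
  sum h ≡ sum (h ∘ τ)
sum-reindex τ τ-inj h =
  sum-permute h (permutation τ (proj₁ ∘ onto) (proj₂ ∘ onto) (λ x → τ-inj (proj₂ (onto (τ x)))))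
  where onto = injective⇒surjective τ τ-inj

-- A hamiltonian graph has a hamiltonian path starting at any vertex

record HamiltonianPathFrom {N : ℕ} (G : FinSimpleGraph (suc N)) (w : Fin (suc N)) : Set where
  field
    vertexAt    : Fin (suc N) → Fin (suc N)
    injective   : Injective _≡_ _≡_ vertexAt
    starts      : vertexAt fzero ≡ w
    consecutive : ∀ a b → toℕ b ≡ suc (toℕ a) → Adj G (vertexAt a) (vertexAt b)

-- The cyclic rotation j ↦ r + j (mod n) of Fin n, realised without division:
-- r + j < 2n, so at most one subtraction of n is needed.
module Rotation (N : ℕ) (r : Fin (suc N)) where
  n = suc N

  reduce : (x : ℕ) → x < n + n → Fin n
  reduce x x<2n with x <? n
  ... | yes x<n = fromℕ< x<n
  ... | no  _   = fromℕ< (m<n+o⇒m∸n<o x n x<2n)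

  reduce-low : ∀ x x<2n → x < n → toℕ (reduce x x<2n) ≡ x
  reduce-low x x<2n x<n with x <? n
  ... | yes x<n′ = FinP.toℕ-fromℕ< x<n′
  ... | no  x≮n  = contradiction x<n x≮n

  reduce-high : ∀ x x<2n → n ≤ x → toℕ (reduce x x<2n) ≡ x ∸ n
  reduce-high x x<2n n≤x with x <? n
  ... | yes x<n = contradiction x<n (≤⇒≯ n≤x)
  ... | no  _   = FinP.toℕ-fromℕ< (m<n+o⇒m∸n<o x n x<2n)

  shifted<2n : ∀ (j : Fin n) → toℕ r + toℕ j < n + n
  shifted<2n j = +-mono-< (FinP.toℕ<n r) (FinP.toℕ<n j)

  rotate : Fin n → Fin n
  rotate j = reduce (toℕ r + toℕ j) (shifted<2n j)

  rotate-zero : rotate fzero ≡ r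
  rotate-zero = FinP.toℕ-injective (trans (reduce-low _ (shifted<2n fzero) r+0<n) (+-identityʳ _))
    where r+0<n = subst (_< n) (sym (+-identityʳ _)) (FinP.toℕ<n r)

  -- A wrapped value r + b - n lies below r, hence below every unwrapped r + a.
  wrapped<unwrapped : ∀ (a b : Fin n) → n ≤ toℕ r + toℕ b → toℕ r + toℕ a ≢ (toℕ r + toℕ b) ∸ n
  wrapped<unwrapped a b n≤ eq = <-irrefl refl (≤-trans (s≤s (m≤m+n (toℕ r) (toℕ a)))
                                                       (≤-trans (≤-reflexive (cong suc eq)) wrapped<r))
    where
    wrapped<r : (toℕ r + toℕ b) ∸ n < toℕ r
    wrapped<r = +-cancelʳ-< n _ (toℕ r)
      (subst (_< toℕ r + n) (sym (m∸n+n≡m n≤)) (+-monoʳ-< (toℕ r) (FinP.toℕ<n b)))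

  rotate-injective : Injective _≡_ _≡_ rotate
  rotate-injective {a} {b} eq = by-cases (toℕ r + toℕ a <? n) (toℕ r + toℕ b <? n)
    where
    by-cases : Dec (toℕ r + toℕ a < n) → Dec (toℕ r + toℕ b < n) → a ≡ b
    by-cases (yes a<) (yes b<) = FinP.toℕ-injective (+-cancelˡ-≡ (toℕ r) _ _
      (trans (sym (reduce-low _ _ a<)) (trans (cong toℕ eq) (reduce-low _ _ b<))))
    by-cases (yes a<) (no b≮) = ⊥-elim (wrapped<unwrapped a b (≮⇒≥ b≮)
      (trans (sym (reduce-low _ _ a<)) (trans (cong toℕ eq) (reduce-high _ _ (≮⇒≥ b≮)))))
    by-cases (no a≮) (yes b<) = ⊥-elim (wrapped<unwrapped b a (≮⇒≥ a≮)
      (trans (sym (reduce-low _ _ b<)) (trans (cong toℕ (sym eq)) (reduce-high _ _ (≮⇒≥ a≮)))))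
    by-cases (no a≮) (no b≮) = FinP.toℕ-injective (+-cancelˡ-≡ (toℕ r) _ _ (∸-cancelʳ-≡ (≮⇒≥ a≮) (≮⇒≥ b≮)
      (trans (sym (reduce-high _ _ (≮⇒≥ a≮))) (trans (cong toℕ eq) (reduce-high _ _ (≮⇒≥ b≮))))))

  rotate-succ : ∀ (a b : Fin n) → toℕ b ≡ suc (toℕ a) → CyclicSucc (rotate a) (rotate b)
  rotate-succ a b b≡1+a = by-cases (toℕ r + toℕ a <? n) (toℕ r + toℕ b <? n)
    where
    r+b≡1+r+a : toℕ r + toℕ b ≡ suc (toℕ r + toℕ a)
    r+b≡1+r+a = trans (cong (toℕ r +_) b≡1+a) (+-suc (toℕ r) (toℕ a))

    by-cases : Dec (toℕ r + toℕ a < n) → Dec (toℕ r + toℕ b < n) → CyclicSucc (rotate a) (rotate b)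
    by-cases (yes a<) (yes b<) =
      inj₁ (trans (reduce-low _ _ b<) (trans r+b≡1+r+a (cong suc (sym (reduce-low _ _ a<)))))
    by-cases (yes a<) (no b≮) =
      inj₂ (trans (reduce-low _ _ a<) (cong (_∸ 1) 1+r+a≡n) ,
            trans (reduce-high _ _ (≮⇒≥ b≮)) (trans (cong (_∸ n) (trans r+b≡1+r+a 1+r+a≡n)) (n∸n≡0 n)))
      where
      1+r+a≡n : suc (toℕ r + toℕ a) ≡ n
      1+r+a≡n = ≤-antisym a< (subst (n ≤_) r+b≡1+r+a (≮⇒≥ b≮))
    by-cases (no a≮) (yes b<) = ⊥-elim (a≮ (≤-trans (n≤1+n _) (subst (_< n) r+b≡1+r+a b<)))
    by-cases (no a≮) (no b≮) =
      inj₁ (trans (reduce-high _ _ (≮⇒≥ b≮)) (trans (cong (_∸ n) r+b≡1+r+a)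
        (trans (+-∸-assoc 1 (≮⇒≥ a≮)) (cong suc (sym (reduce-high _ _ (≮⇒≥ a≮)))))))

hamiltonian⇒pathFrom : ∀ {N} (G : FinSimpleGraph (suc N)) → Hamiltonian G →
  (w : Fin (suc N)) → HamiltonianPathFrom G w
hamiltonian⇒pathFrom {N} G (_ , σ , σ-inj , cycle) w = record
  { vertexAt    = σ ∘ rotate
  ; injective   = rotate-injective ∘ σ-inj
  ; starts      = trans (cong σ rotate-zero) σr≡w
  ; consecutive = λ a b b≡1+a → cycle (rotate a) (rotate b) (rotate-succ a b b≡1+a)
  }
  where
  r    = proj₁ (injective⇒surjective σ σ-inj w)
  σr≡w = proj₂ (injective⇒surjective σ σ-inj w)
  open Rotation N r

module Ascending {n : ℕ} where

  data Ascending : ℕ → List (Fin n) → Set where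
    []  : ∀ {lo} → Ascending lo []
    _∷_ : ∀ {lo x xs} → lo ≤ toℕ x → Ascending (suc (toℕ x)) xs → Ascending lo (x ∷ xs)

  weaken : ∀ {lo lo′ xs} → lo′ ≤ lo → Ascending lo xs → Ascending lo′ xs
  weaken lo′≤lo []         = []
  weaken lo′≤lo (lo≤x ∷ a) = ≤-trans lo′≤lo lo≤x ∷ a

  tabulate-ascending : ∀ {m} (a : ℕ) (g : Fin m → Fin n) → (∀ i → toℕ (g i) ≡ a + toℕ i) →
    Ascending a (tabulate g)
  tabulate-ascending {zero}  a g g-spec = []
  tabulate-ascending {suc m} a g g-spec =
    ≤-reflexive (sym g₀≡a) ∷
    weaken (≤-reflexive (cong suc g₀≡a))
           (tabulate-ascending (suc a) (g ∘ fsuc) (λ i → trans (g-spec (fsuc i)) (+-suc a (toℕ i))))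
    where g₀≡a = trans (g-spec fzero) (+-identityʳ a)

  allFin-ascending : Ascending 0 (allFin n)
  allFin-ascending = tabulate-ascending 0 id (λ _ → refl)

  filter-ascending : ∀ {p} {P : Fin n → Set p} (P? : Decidable P) {lo xs} →
    Ascending lo xs → Ascending lo (filter P? xs)
  filter-ascending P? [] = []
  filter-ascending P? {xs = x ∷ xs} (lo≤x ∷ a) with does (P? x)
  ... | true  = lo≤x ∷ filter-ascending P? a
  ... | false = weaken (≤-trans lo≤x (n≤1+n _)) (filter-ascending P? a)

  nth : Fin n → List (Fin n) → ℕ → Fin n
  nth d []       m       = d
  nth d (x ∷ xs) zero    = x
  nth d (x ∷ xs) (suc m) = nth d xs m

  nth-lower : ∀ d {lo xs} → Ascending lo xs → ∀ m → m < length xs → lo + m ≤ toℕ (nth d xs m)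
  nth-lower d (lo≤x ∷ a) zero    _ = subst (_≤ _) (sym (+-identityʳ _)) lo≤x
  nth-lower d {lo} (lo≤x ∷ a) (suc m) (s≤s m<) =
    ≤-trans (≤-reflexive (+-suc lo m)) (≤-trans (s≤s (+-monoˡ-≤ m lo≤x)) (nth-lower d a m m<))

  nth-gap : ∀ d {lo xs} → Ascending lo xs → ∀ m t → m + t < length xs →
    toℕ (nth d xs m) + t ≤ toℕ (nth d xs (m + t))
  nth-gap d (_ ∷ a) zero    zero    _        = ≤-reflexive (+-identityʳ _)
  nth-gap d (_ ∷ a) zero    (suc t) (s≤s t<) = ≤-trans (≤-reflexive (+-suc _ t)) (nth-lower d a t t<)
  nth-gap d (_ ∷ a) (suc m) t       (s≤s m+t<) = nth-gap d a m t m+t<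

  nth-mono : ∀ d {lo xs} → Ascending lo xs → ∀ {m m′} → m ≤ m′ → m′ < length xs →
    toℕ (nth d xs m) ≤ toℕ (nth d xs m′)
  nth-mono d {xs = xs} a {m} {m′} m≤m′ m′< =
    ≤-trans (m≤m+n _ (m′ ∸ m))
      (subst (λ z → toℕ (nth d xs m) + (m′ ∸ m) ≤ toℕ (nth d xs z)) m+[m′∸m]≡m′
        (nth-gap d a m (m′ ∸ m) (subst (_< _) (sym m+[m′∸m]≡m′) m′<)))
    where m+[m′∸m]≡m′ = m+[n∸m]≡n m≤m′

  nth-filter : ∀ d {p} {P : Fin n → Set p} (P? : Decidable P) xs m →
    m < length (filter P? xs) → P (nth d (filter P? xs) m)
  nth-filter d P? (x ∷ xs) m m< with P? x
  nth-filter d P? (x ∷ xs) zero    _        | yes px = px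
  nth-filter d P? (x ∷ xs) (suc m) (s≤s m<) | yes px = nth-filter d P? xs m m<
  ... | no _ = nth-filter d P? xs m m<

offset : (f : ℕ) (ℓ : Fin f → ℕ) → Fin f → ℕ
offset (suc f) ℓ fzero    = 0
offset (suc f) ℓ (fsuc i) = ℓ fzero + offset f (ℓ ∘ fsuc) i

offset-end≤legSum : ∀ f ℓ i → offset f ℓ i + ℓ i ≤ legSum f ℓ
offset-end≤legSum (suc f) ℓ fzero    = m≤m+n _ _
offset-end≤legSum (suc f) ℓ (fsuc i) =
  ≤-trans (≤-reflexive (+-assoc (ℓ fzero) _ _)) (+-monoʳ-≤ (ℓ fzero) (offset-end≤legSum f (ℓ ∘ fsuc) i))

offset-end≤offset : ∀ f ℓ (i i′ : Fin f) → toℕ i < toℕ i′ → offset f ℓ i + ℓ i ≤ offset f ℓ i′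
offset-end≤offset (suc f) ℓ fzero    (fsuc i′) _        = m≤m+n _ _
offset-end≤offset (suc f) ℓ (fsuc i) (fsuc i′) (s≤s i<i′) =
  ≤-trans (≤-reflexive (+-assoc (ℓ fzero) _ _)) (+-monoʳ-≤ (ℓ fzero) (offset-end≤offset f (ℓ ∘ fsuc) i i′ i<i′))

-- Embedding a spider along a hamiltonian path from a vertex of large degree

module SpiderAlongPath {N : ℕ} (G : FinSimpleGraph (suc N)) {c : Fin (suc N)}
  (path : HamiltonianPathFrom G c)
  (f : ℕ) (ℓ : Fin f → ℕ) (ℓ≥1 : ∀ i → 1 ≤ ℓ i) (legs≤deg : legSum f ℓ ≤ degree G c) where

  open HamiltonianPathFrom path
  open Ascending {suc N}

  IsNeighbourAt : Fin (suc N) → Set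
  IsNeighbourAt j = Adj G c (vertexAt j)

  isNeighbourAt? : Decidable IsNeighbourAt
  isNeighbourAt? j = adj? G c (vertexAt j)

  neighbourPositions : List (Fin (suc N))
  neighbourPositions = filter isNeighbourAt? (allFin (suc N))

  -- The path visits every vertex once, so it meets all deg(c) neighbours of c.
  neighbourCount : length neighbourPositions ≡ degree G c
  neighbourCount = begin
    length neighbourPositions                  ≡⟨ count-tabulate isNeighbourAt? id ⟩
    sum (λ j → indicator (adj? G c (vertexAt j))) ≡⟨ sum-reindex vertexAt injective (λ v → indicator (adj? G c v)) ⟨
    sum (λ v → indicator (adj? G c v))          ≡⟨⟩
    degree G c                                 ∎
    where open ≡-Reasoning

  nbr : ℕ → Fin (suc N)
  nbr = nth fzero neighbourPositions

  nbr-ascending : Ascending 0 neighbourPositions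
  nbr-ascending = filter-ascending isNeighbourAt? allFin-ascending

  nbr-adjacent : ∀ m → m < length neighbourPositions → IsNeighbourAt (nbr m)
  nbr-adjacent = nth-filter fzero isNeighbourAt? (allFin (suc N))

  -- Position 0 holds c itself, which is not its own neighbour.
  nbr-positive : ∀ m → m < length neighbourPositions → 1 ≤ toℕ (nbr m)
  nbr-positive m m< = positive (nbr m) (nbr-adjacent m m<)
    where
    positive : ∀ j → IsNeighbourAt j → 1 ≤ toℕ j
    positive fzero    c~c = ⊥-elim (irrefl G (subst (λ v → Adj G c v) starts c~c))
    positive (fsuc j) _   = s≤s z≤n

  legEnd≤ : ∀ i → offset f ℓ i + ℓ i ≤ length neighbourPositions
  legEnd≤ i = ≤-trans (offset-end≤legSum f ℓ i) (≤-trans legs≤deg (≤-reflexive (sym neighbourCount)))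

  offset<len : ∀ i → offset f ℓ i < length neighbourPositions
  offset<len i = ≤-trans (≤-reflexive (+-comm 1 _)) (≤-trans (+-monoʳ-≤ (offset f ℓ i) (ℓ≥1 i)) (legEnd≤ i))

  legStart : Fin f → ℕ
  legStart i = toℕ (nbr (offset f ℓ i))

  position : SpiderV f ℓ → ℕ
  position root      = 0
  position (leg i p) = legStart i + toℕ p

  position<n : ∀ v → position v < suc N
  position<n root      = s≤s z≤n
  position<n (leg i p) = ≤-trans (s≤s (nth-gap fzero nbr-ascending (offset f ℓ i) (toℕ p) inside))
                                 (FinP.toℕ<n _)
    where inside = ≤-trans (+-monoʳ-< (offset f ℓ i) (FinP.toℕ<n p)) (legEnd≤ i)

  earlier-leg : ∀ i i′ (p : Fin (ℓ i)) (p′ : Fin (ℓ i′)) → toℕ i < toℕ i′ →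
    position (leg i p) < position (leg i′ p′)
  earlier-leg i i′ p p′ i<i′ = begin-strict
    legStart i + toℕ p                 <⟨ +-monoʳ-< (legStart i) (FinP.toℕ<n p) ⟩
    legStart i + ℓ i                   ≤⟨ nth-gap fzero nbr-ascending (offset f ℓ i) (ℓ i) end< ⟩
    toℕ (nbr (offset f ℓ i + ℓ i))     ≤⟨ nth-mono fzero nbr-ascending gap (offset<len i′) ⟩
    legStart i′                        ≤⟨ m≤m+n _ _ ⟩
    legStart i′ + toℕ p′               ∎
    where
    open ≤-Reasoning
    gap  = offset-end≤offset f ℓ i i′ i<i′
    end< = ≤-trans (s≤s gap) (offset<len i′)

  -- Within a leg positions differ by the offset along the leg; across legs use earlier-leg.
  position-injective : ∀ u v → position u ≡ position v → u ≡ v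
  position-injective root root _ = refl
  position-injective root (leg i p) 0≡ =
    ⊥-elim (1+n≰n (subst (1 ≤_) (sym 0≡) (≤-trans (nbr-positive _ (offset<len i)) (m≤m+n _ _))))
  position-injective (leg i p) root ≡0 =
    ⊥-elim (1+n≰n (subst (1 ≤_) ≡0 (≤-trans (nbr-positive _ (offset<len i)) (m≤m+n _ _))))
  position-injective (leg i p) (leg i′ p′) eq with <-cmp (toℕ i) (toℕ i′)
  ... | tri< i<i′ _ _ = ⊥-elim (<-irrefl eq (earlier-leg i i′ p p′ i<i′))
  ... | tri> _ _ i′<i = ⊥-elim (<-irrefl (sym eq) (earlier-leg i′ i p′ p i′<i))
  ... | tri≈ _ i≡i′ _ with FinP.toℕ-injective i≡i′
  ...   | refl = cong (leg i) (FinP.toℕ-injective (+-cancelˡ-≡ (legStart i) _ _ eq))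

  embed : SpiderV f ℓ → Fin (suc N)
  embed v = vertexAt (fromℕ< (position<n v))

  embed-injective : Injective _≡_ _≡_ embed
  embed-injective {u} {v} eq = position-injective u v (begin
    position u                     ≡⟨ FinP.toℕ-fromℕ< (position<n u) ⟨
    toℕ (fromℕ< (position<n u))    ≡⟨ cong toℕ (injective eq) ⟩
    toℕ (fromℕ< (position<n v))    ≡⟨ FinP.toℕ-fromℕ< (position<n v) ⟩
    position v                     ∎)
    where open ≡-Reasoning

  -- Root edges land on neighbours of c; leg edges on consecutive path vertices.
  embed-edges : ∀ u v → SpiderEdge f ℓ u v → Adj G (embed u) (embed v)
  embed-edges .root .(leg i z) (rootEdge i z z≡0) =
    subst₂ (Adj G) (sym starts)
                   (cong vertexAt (sym (FinP.toℕ-injective (trans (FinP.toℕ-fromℕ< _) start≡))))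
                   (nbr-adjacent _ (offset<len i))
    where
    start≡ : legStart i + toℕ z ≡ legStart i
    start≡ = trans (cong (legStart i +_) z≡0) (+-identityʳ _)
  embed-edges .(leg i p) .(leg i q) (legEdge i p q q≡1+p) = consecutive _ _ (begin
    toℕ (fromℕ< (position<n (leg i q))) ≡⟨ FinP.toℕ-fromℕ< _ ⟩
    legStart i + toℕ q                   ≡⟨ cong (legStart i +_) q≡1+p ⟩
    legStart i + suc (toℕ p)             ≡⟨ +-suc _ _ ⟩
    suc (legStart i + toℕ p)             ≡⟨ cong suc (FinP.toℕ-fromℕ< _) ⟨
    suc (toℕ (fromℕ< (position<n (leg i p)))) ∎)
    where open ≡-Reasoning

  spider : SpiderIn f ℓ G
  spider = embed , embed-injective , embed-edges

corollary2 : (k : ℕ) → 1 ≤ k →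
    (n : ℕ) (G : FinSimpleGraph n) → Hamiltonian G →
    n * (k ∸ 1) < 2 * edgeCount G →
    (f : ℕ) (ℓ : Fin f → ℕ) → 1 ≤ f → (∀ i → 1 ≤ ℓ i) → legSum f ℓ ≡ k →
    SpiderIn f ℓ G
corollary2 (suc k′) _ zero    G (() , _) _ f ℓ _ _ _
corollary2 (suc k′) _ (suc N) G ham dense f ℓ _ ℓ≥1 legs≡k =
  SpiderAlongPath.spider G (hamiltonian⇒pathFrom G ham c) f ℓ ℓ≥1 legs≤deg
  where
  -- Some vertex c has degree at least k, since Σ deg ≥ 2e(G) > n(k-1).
  heavy : ∃ λ v → k′ < degree G v
  heavy = exceeds-average (degree G) k′ (≤-trans dense (handshake G))
  c : Fin (suc N)
  c = proj₁ heavy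
  legs≤deg : legSum f ℓ ≤ degree G c
  legs≤deg = subst (_≤ degree G c) (sym legs≡k) (proj₂ heavy)
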